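{- Let $k$ and $n$ be positive integers, let $P$ be a $(kn,n)$-Dyck path, and let $\sigma=(\sigma_1,\dots,\sigma_{kn+n})$ be the output sequence of the sweep map applied from right to left to $P$. Run the following algorithm on input $\sigma$, producing a sequence $\tau=(\tau_1,\dots,\tau_{kn+n})$ whose entries are initially empty: Assign $\tau_1=0$. For $i=2$ to $kn+n$: if $\tau_i$ is empty, then (a) if $\sigma_i=\mathrm{S}$, set $\tau_i=\tau_{i-1}$; (b) if $\sigma_i=\mathrm{W}$, let $x$ be the number of entries assigned so far in $\tau$ equal to $\tau_{i-1}$ minus the number of entries assigned so far in $\tau$ equal to $\tau_{i-1}-kn$ whose corresponding letter in $\sigma$ is S; if $x$ is positive, assign the level $\tau_{i-1}+n$ to the entries of $\tau$ at the positions of the next $x$ letters W in $\sigma$ (beginning with $\sigma_i$); if $x$ is negative, assign the level $\tau_{i-1}$ to the entries of $\tau$ at the positions of the next $|x|$ letters W in $\sigma$ (beginning with $\sigma_i$). If $\tau_i$ is not empty, skip to the next $i$. Then the output $\tau$ equals the sequence of levels of the sweep map, i.e. $\tau_j$ is the level of the step listed in position $j$ of the sweep map output.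
   Context: A $(kn,n)$-Dyck path is a lattice path from $(0,0)$ to $(kn,n)$ consisting of $kn$ unit east steps and $n$ unit north steps that never passes below the line $y=x/k$. The level of a lattice point $(x,y)$ is $kn\cdot y-n\cdot x$; thus the path stays at levels $\ge 0$, a north step raises the level by $kn$ and an east step lowers it by $n$. Each step is recorded by its starting point: a north step is recorded as S (its south endpoint) and an east step as W (its west endpoint); the level of a step is the level of its starting point. The sweep map applied from right to left lists all $kn+n$ steps in order of nondecreasing level, where among steps of equal level the one occurring later along the path (further to the right) is listed first. The output sequence $\sigma$ is the resulting word in the letters S and W; the associated (rank) sequence of levels lists, for each position $j$, the level of the step listed in position $j$. -}

module Defs where

open import Data.Nat as ℕ using (ℕ; zero; suc; _∸_)
open import Data.Integer as ℤ using (ℤ; +_; _+_; _-_; _<?_; _≟_)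
open import Data.List using (List; []; _∷_; length; filter; map; foldl; upTo; replicate; take; drop; _++_; zip)
open import Data.Maybe using (Maybe; just; nothing)
open import Data.Product using (_×_; _,_; proj₁; proj₂)
open import Data.Bool using (if_then_else_)
open import Relation.Nullary using (yes; no; does)
open import Data.List.Relation.Unary.All using (All)
open import Relation.Binary.PropositionalEquality using (_≡_)

data Step : Set where
  N E : Step

-- Letters of the sweep output: S (a north step, recorded by its south
-- endpoint) and W (an east step, recorded by its west endpoint).
data Letter : Set where
  S W : Letter

letter : Step → Letter
letter N = S
letter E = W

countN : List Step → ℕ
countN []      = 0
countN (N ∷ p) = suc (countN p)
countN (E ∷ p) = countN p

countE : List Step → ℕ
countE []      = 0
countE (N ∷ p) = countE p
countE (E ∷ p) = suc (countE p)

-- Starting level of each step of a path, starting from level l.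
-- The level of (x,y) is kn*y - n*x: a north step adds kn, an east step subtracts n.
startLevels : ℕ → ℕ → ℤ → List Step → List ℤ
startLevels k n l []      = []
startLevels k n l (N ∷ p) = l ∷ startLevels k n (l + + (k ℕ.* n)) p
startLevels k n l (E ∷ p) = l ∷ startLevels k n (l - + n) p

-- A (kn,n)-Dyck path: kn east steps, n north steps, never below y = x/k
-- (i.e. every lattice point visited has level ≥ 0; the final point has level 0).
record IsDyck (k n : ℕ) (P : List Step) : Set where
  field
    northCount : countN P ≡ n
    eastCount  : countE P ≡ k ℕ.* n
    nonneg     : All (λ l → + 0 ℤ.≤ l) (startLevels k n (+ 0) P)

labelledSteps : ℕ → ℕ → List Step → List (ℤ × Letter)
labelledSteps k n P = zip (startLevels k n (+ 0) P) (map letter P)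

insertLevel : ℤ × Letter → List (ℤ × Letter) → List (ℤ × Letter)
insertLevel x []       = x ∷ []
insertLevel x (y ∷ ys) with proj₁ x <? proj₁ y
... | yes _ = x ∷ y ∷ ys
... | no  _ = y ∷ insertLevel x ys

-- Sweep map output (with levels): the steps ordered by nondecreasing level,
-- and among equal levels the step occurring later along the path first.
-- (Right fold: the leftmost step is inserted last, hence after all equal-level
-- steps lying to its right.)
sweepRL : ℕ → ℕ → List Step → List (ℤ × Letter)
sweepRL k n P = Data.List.foldr insertLevel [] (labelledSteps k n P)
  where import Data.List

sweepWord : ℕ → ℕ → List Step → List Letter
sweepWord k n P = map proj₂ (sweepRL k n P)

sweepLevels : ℕ → ℕ → List Step → List ℤ
sweepLevels k n P = map proj₁ (sweepRL k n P)

-- The algorithm of the theorem (positions are 0-based here; position 0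
-- corresponds to τ_1).

at : {A : Set} → List A → ℕ → Maybe A
at []       _       = nothing
at (x ∷ xs) zero    = just x
at (x ∷ xs) (suc i) = at xs i

set : {A : Set} → ℕ → A → List A → List A
set _       a []       = []
set zero    a (x ∷ xs) = a ∷ xs
set (suc i) a (x ∷ xs) = x ∷ set i a xs

isJust≡ : ℤ → Maybe ℤ → Data.Bool.Bool
isJust≡ v nothing  = Data.Bool.false
isJust≡ v (just w) = does (v ≟ w)
  where import Data.Bool

countEq : ℤ → List (Maybe ℤ) → ℕ
countEq v τ = length (filter (λ t → isJust≡ v t Data.Bool.≟ Data.Bool.true) τ)
  where import Data.Bool

countEqS : ℤ → List Letter → List (Maybe ℤ) → ℕ
countEqS v (S ∷ σ) (t ∷ τ) = if isJust≡ v t then suc (countEqS v σ τ) else countEqS v σ τ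
countEqS v (W ∷ σ) (t ∷ τ) = countEqS v σ τ
countEqS v _       _       = 0

assignW : ℕ → ℤ → List Letter → List (Maybe ℤ) → List (Maybe ℤ)
assignW zero    v σ       τ       = τ
assignW (suc c) v []      τ       = τ
assignW (suc c) v (S ∷ σ) []      = []
assignW (suc c) v (W ∷ σ) []      = []
assignW (suc c) v (S ∷ σ) (t ∷ τ) = t ∷ assignW (suc c) v σ τ
assignW (suc c) v (W ∷ σ) (t ∷ τ) = just v ∷ assignW c v σ τ

assignFrom : ℕ → ℕ → ℤ → List Letter → List (Maybe ℤ) → List (Maybe ℤ)
assignFrom i c v σ τ = take i τ ++ assignW c v (drop i σ) (drop i τ)

algStep : ℕ → ℕ → List Letter → List (Maybe ℤ) → ℕ → List (Maybe ℤ)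
algStep k n σ τ zero    = τ
algStep k n σ τ (suc j) with at τ (suc j) | at τ j | at σ (suc j)
... | just nothing | just (just prev) | just S = set (suc j) (just prev) τ
... | just nothing | just (just prev) | just W with
        + countEq prev τ - + countEqS (prev - + (k ℕ.* n)) σ τ
...   | +_ zero      = τ
...   | +_ (suc c)   = assignFrom (suc j) (suc c) (prev + + n) σ τ
...   | ℤ.-[1+_] c   = assignFrom (suc j) (suc c) prev σ τ
algStep k n σ τ (suc j) | _ | _ | _ = τ

runAlg : ℕ → ℕ → List Letter → List (Maybe ℤ)
runAlg k n σ = foldl (algStep k n σ) initial (map suc (upTo (length σ ∸ 1)))
  where
    initial : List (Maybe ℤ)
    initial with length σ
    ... | zero  = []
    ... | suc m = just (+ 0) ∷ replicate m nothing

module Submission where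

-- All levels are multiples of n, so after dividing by n every east step lowers the level by
-- exactly 1; inserting the steps of a path one by one therefore shows that the sweep output
-- climbs from level 0 in increments of 0 or n, and can only rise at a W.  A closed path
-- departs from each level L exactly as often as it arrives there, and it arrives at L by an
-- east step from L + n or a north step from L - kn.  So when the algorithm meets the first W
-- of a new level L + n, the number x it computes is (#steps at L) - (#S at L - kn), which is
-- the number of W at L + n; it is positive and exactly those entries receive L + n.  Every
-- other entry either copies the current level or was filled by such a rise, and induction
-- over the positions gives τ = the level sequence.

open import Defs
open import Data.Bool using (Bool; true; false; _∧_; if_then_else_)
open import Data.Bool.Properties using (∧-zeroʳ)
open import Data.Empty using (⊥-elim)
open import Data.Integer as ℤ using (ℤ; +_; _+_; _-_; _<?_; _≟_)
import Data.Integer.Properties as ℤP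
open import Data.Integer.Tactic.RingSolver using (solve-∀)
open import Data.List using (List; []; _∷_; _++_; _∷ʳ_; length; map; foldr; foldl; zip; take; drop; replicate; filter; applyUpTo; upTo)
import Data.List.Properties as LP
open import Data.List.Relation.Unary.All as All using (All; []; _∷_)
import Data.List.Relation.Unary.All.Properties as AllP
open import Data.Nat as ℕ using (ℕ; zero; suc)
import Data.Nat.Properties as ℕP
import Data.Nat.Tactic.RingSolver as ℕSolver
open import Algebra.Properties.CommutativeSemigroup ℕP.+-commutativeSemigroup using (x∙yz≈y∙xz)
open import Data.List.Relation.Unary.Any using (Any; here; there)
open import Data.Sum using (_⊎_; inj₁; inj₂)
open import Function using (_∘_)
open import Data.Maybe using (Maybe; just; nothing)
open import Data.Product using (_×_; _,_; proj₁; proj₂)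
open import Relation.Nullary using (yes; no; does)
open import Relation.Binary.PropositionalEquality
open ≡-Reasoning

Labelled : Set
Labelled = ℤ × Letter

level : Labelled → ℤ
level = proj₁

infix 4 _≡ᵇ_
_≡ᵇ_ : ℤ → ℤ → Bool
a ≡ᵇ b = does (a ≟ b)

≡ᵇ-refl : ∀ a → (a ≡ᵇ a) ≡ true
≡ᵇ-refl a with a ≟ a
... | yes _ = refl
... | no a≢a = ⊥-elim (a≢a refl)

≢⇒≡ᵇ-false : ∀ {a b} → a ≢ b → (a ≡ᵇ b) ≡ false
≢⇒≡ᵇ-false {a} {b} a≢b with a ≟ b
... | yes a≡b = ⊥-elim (a≢b a≡b)
... | no _ = refl

≡ᵇ-cong-⇔ : ∀ {a b c d} → (a ≡ b → c ≡ d) → (c ≡ d → a ≡ b) → (a ≡ᵇ b) ≡ (c ≡ᵇ d)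
≡ᵇ-cong-⇔ {a} {b} {c} {d} to from with a ≟ b | c ≟ d
... | yes _   | yes _   = refl
... | no _    | no _    = refl
... | yes a≡b | no c≢d  = ⊥-elim (c≢d (to a≡b))
... | no a≢b  | yes c≡d = ⊥-elim (a≢b (from c≡d))

≡ᵇ-shift : ∀ L s m → (L ≡ᵇ (s + m)) ≡ ((L - m) ≡ᵇ s)
≡ᵇ-shift L s m = ≡ᵇ-cong-⇔ (λ e → trans (cong (_- m) e) (cancel s m)) (λ e → trans (sym (uncancel L m)) (cong (_+ m) e))
  where
  cancel : ∀ s m → s + m - m ≡ s
  cancel = solve-∀
  uncancel : ∀ L m → L - m + m ≡ L
  uncancel = solve-∀

-- Counting steps by level

indicator : Bool → ℕ
indicator true  = 1
indicator false = 0

count : (Labelled → Bool) → List Labelled → ℕ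
count f []       = 0
count f (x ∷ xs) = indicator (f x) ℕ.+ count f xs

count-++ : ∀ f xs ys → count f (xs ++ ys) ≡ count f xs ℕ.+ count f ys
count-++ f []       ys = refl
count-++ f (x ∷ xs) ys = trans (cong (indicator (f x) ℕ.+_) (count-++ f xs ys)) (sym (ℕP.+-assoc (indicator (f x)) _ _))

isW isS anyLetter : Letter → Bool
isW W = true
isW S = false
isS S = true
isS W = false
anyLetter _ = true

_atLevel_ : (Letter → Bool) → ℤ → Labelled → Bool
(p atLevel L) (l , c) = p c ∧ (L ≡ᵇ l)

count-atLevel-absent : ∀ p L xs → All (λ y → L ≢ level y) xs → count (p atLevel L) xs ≡ 0
count-atLevel-absent p L []             []         = refl
count-atLevel-absent p L ((l , c) ∷ xs) (L≢l ∷ ≢s) =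
  cong₂ ℕ._+_ (cong indicator (trans (cong (p c ∧_) (≢⇒≡ᵇ-false L≢l)) (∧-zeroʳ (p c)))) (count-atLevel-absent p L xs ≢s)

-- Levels along a path

labelsFrom : ℕ → ℕ → ℤ → List Step → List Labelled
labelsFrom k n s []      = []
labelsFrom k n s (N ∷ P) = (s , S) ∷ labelsFrom k n (s + + (k ℕ.* n)) P
labelsFrom k n s (E ∷ P) = (s , W) ∷ labelsFrom k n (s - + n) P

zip-startLevels : ∀ k n s P → zip (startLevels k n s P) (map letter P) ≡ labelsFrom k n s P
zip-startLevels k n s []      = refl
zip-startLevels k n s (N ∷ P) = cong ((s , S) ∷_) (zip-startLevels k n _ P)
zip-startLevels k n s (E ∷ P) = cong ((s , W) ∷_) (zip-startLevels k n _ P)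

endLevel : ℕ → ℕ → ℤ → List Step → ℤ
endLevel k n s []      = s
endLevel k n s (N ∷ P) = endLevel k n (s + + (k ℕ.* n)) P
endLevel k n s (E ∷ P) = endLevel k n (s - + n) P

departures : ℤ → List Labelled → ℕ
departures L = count (anyLetter atLevel L)

-- a step ends at level L iff it is an east step from L + n or a north step from L - kn
arrivals : ℕ → ℕ → ℤ → List Labelled → ℕ
arrivals k n L xs = count (isW atLevel (L + + n)) xs ℕ.+ count (isS atLevel (L - + (k ℕ.* n))) xs

path-balance : ∀ k n L s P →
  departures L (labelsFrom k n s P) ℕ.+ indicator (L ≡ᵇ endLevel k n s P) ≡
  indicator (L ≡ᵇ s) ℕ.+ arrivals k n L (labelsFrom k n s P)
path-balance k n L s [] = ℕP.+-comm 0 _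
path-balance k n L s (N ∷ P) = begin
  (a ℕ.+ departures L xs) ℕ.+ e              ≡⟨ ℕP.+-assoc a _ e ⟩
  a ℕ.+ (departures L xs ℕ.+ e)              ≡⟨ cong (a ℕ.+_) (path-balance k n L s' P) ⟩
  a ℕ.+ (indicator (L ≡ᵇ s') ℕ.+ (w ℕ.+ t))  ≡⟨ cong (λ b → a ℕ.+ (indicator b ℕ.+ (w ℕ.+ t))) north-shift ⟩
  a ℕ.+ (b ℕ.+ (w ℕ.+ t))                    ≡⟨ cong (a ℕ.+_) (x∙yz≈y∙xz b w t) ⟩
  a ℕ.+ (w ℕ.+ (b ℕ.+ t))                    ∎
  where
  s' = s + + (k ℕ.* n)
  xs = labelsFrom k n s' P
  a = indicator (L ≡ᵇ s)
  b = indicator ((L - + (k ℕ.* n)) ≡ᵇ s)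
  e = indicator (L ≡ᵇ endLevel k n s' P)
  w = count (isW atLevel (L + + n)) xs
  t = count (isS atLevel (L - + (k ℕ.* n))) xs
  north-shift : (L ≡ᵇ s') ≡ ((L - + (k ℕ.* n)) ≡ᵇ s)
  north-shift = ≡ᵇ-shift L s (+ (k ℕ.* n))
path-balance k n L s (E ∷ P) = begin
  (a ℕ.+ departures L xs) ℕ.+ e              ≡⟨ ℕP.+-assoc a _ e ⟩
  a ℕ.+ (departures L xs ℕ.+ e)              ≡⟨ cong (a ℕ.+_) (path-balance k n L s' P) ⟩
  a ℕ.+ (indicator (L ≡ᵇ s') ℕ.+ (w ℕ.+ t))  ≡⟨ cong (λ b → a ℕ.+ (indicator b ℕ.+ (w ℕ.+ t))) east-shift ⟩
  a ℕ.+ (b ℕ.+ (w ℕ.+ t))                    ≡⟨ cong (a ℕ.+_) (ℕP.+-assoc b w t) ⟨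
  a ℕ.+ ((b ℕ.+ w) ℕ.+ t)                    ∎
  where
  s' = s - + n
  xs = labelsFrom k n s' P
  a = indicator (L ≡ᵇ s)
  b = indicator ((L + + n) ≡ᵇ s)
  e = indicator (L ≡ᵇ endLevel k n s' P)
  w = count (isW atLevel (L + + n)) xs
  t = count (isS atLevel (L - + (k ℕ.* n))) xs
  east-shift : (L ≡ᵇ s') ≡ ((L + + n) ≡ᵇ s)
  east-shift = trans (≡ᵇ-shift L s (ℤ.- + n)) (cong (λ z → (L + z) ≡ᵇ s) (ℤP.neg-involutive (+ n)))

endLevel-formula : ∀ k m s P → endLevel k m s P ≡ s + + (k ℕ.* m ℕ.* countN P) - + (m ℕ.* countE P)
endLevel-formula k m s [] rewrite ℕP.*-zeroʳ (k ℕ.* m) | ℕP.*-zeroʳ m = sym (trans (ℤP.+-identityʳ (s + + 0)) (ℤP.+-identityʳ s))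
endLevel-formula k m s (N ∷ P) = begin
  endLevel k m (s + + km) P    ≡⟨ endLevel-formula k m (s + + km) P ⟩
  s + + km + + (km ℕ.* cN) - e ≡⟨ shuffle s (+ km) (+ (km ℕ.* cN)) e ⟩
  s + (+ km + + (km ℕ.* cN)) - e ≡⟨ cong (λ z → s + z - e) (ℤP.pos-+ km (km ℕ.* cN)) ⟨
  s + + (km ℕ.+ km ℕ.* cN) - e ≡⟨ cong (λ z → s + + z - e) (ℕP.*-suc km cN) ⟨
  s + + (km ℕ.* suc cN) - e    ∎
  where
  km = k ℕ.* m
  cN = countN P
  e = + (m ℕ.* countE P)
  shuffle : ∀ s a b e → s + a + b - e ≡ s + (a + b) - e
  shuffle = solve-∀
endLevel-formula k m s (E ∷ P) = begin
  endLevel k m (s - + m) P     ≡⟨ endLevel-formula k m (s - + m) P ⟩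
  s - + m + d - + (m ℕ.* cE)   ≡⟨ shuffle s (+ m) d (+ (m ℕ.* cE)) ⟩
  s + d - (+ m + + (m ℕ.* cE)) ≡⟨ cong (λ z → s + d - z) (ℤP.pos-+ m (m ℕ.* cE)) ⟨
  s + d - + (m ℕ.+ m ℕ.* cE)   ≡⟨ cong (λ z → s + d - + z) (ℕP.*-suc m cE) ⟨
  s + d - + (m ℕ.* suc cE)     ∎
  where
  cE = countE P
  d = + (k ℕ.* m ℕ.* countN P)
  shuffle : ∀ s a b e → s - a + b - e ≡ s + b - (a + e)
  shuffle = solve-∀

dyck-closed : ∀ {k n P} → IsDyck k n P → ∀ m s → endLevel k m s P ≡ s
dyck-closed {k} {n} {P} dyck m s = begin
  endLevel k m s P
    ≡⟨ endLevel-formula k m s P ⟩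
  s + + (k ℕ.* m ℕ.* countN P) - + (m ℕ.* countE P)
    ≡⟨ cong₂ (λ a b → s + + (k ℕ.* m ℕ.* a) - + (m ℕ.* b)) northCount eastCount ⟩
  s + + (k ℕ.* m ℕ.* n) - + (m ℕ.* (k ℕ.* n))
    ≡⟨ cong (λ z → s + + (k ℕ.* m ℕ.* n) - + z) (reorder k m n) ⟩
  s + + (k ℕ.* m ℕ.* n) - + (k ℕ.* m ℕ.* n)
    ≡⟨ cancel s (+ (k ℕ.* m ℕ.* n)) ⟩
  s ∎
  where
  open IsDyck dyck
  reorder : ∀ k m n → m ℕ.* (k ℕ.* n) ≡ k ℕ.* m ℕ.* n
  reorder = ℕSolver.solve-∀
  cancel : ∀ s a → s + a - a ≡ s
  cancel = solve-∀

dyck-balance : ∀ {k n P} → IsDyck k n P → ∀ L →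
  departures L (labelsFrom k n (+ 0) P) ≡ arrivals k n L (labelsFrom k n (+ 0) P)
dyck-balance {k} {n} {P} dyck L = ℕP.+-cancelʳ-≡ _ _ _ (begin
  departures L xs ℕ.+ indicator (L ≡ᵇ + 0)
    ≡⟨ cong (λ e → departures L xs ℕ.+ indicator (L ≡ᵇ e)) (dyck-closed dyck n (+ 0)) ⟨
  departures L xs ℕ.+ indicator (L ≡ᵇ endLevel k n (+ 0) P)
    ≡⟨ path-balance k n L (+ 0) P ⟩
  indicator (L ≡ᵇ + 0) ℕ.+ arrivals k n L xs
    ≡⟨ ℕP.+-comm _ (arrivals k n L xs) ⟩
  arrivals k n L xs ℕ.+ indicator (L ≡ᵇ + 0) ∎)
  where xs = labelsFrom k n (+ 0) P

-- The sweep map and rescaling of levels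

sweep : List Labelled → List Labelled
sweep = foldr insertLevel []

sweepRL≡sweep : ∀ k n P → sweepRL k n P ≡ sweep (labelsFrom k n (+ 0) P)
sweepRL≡sweep k n P = cong sweep (zip-startLevels k n (+ 0) P)

count-insertLevel : ∀ f x ys → count f (insertLevel x ys) ≡ count f (x ∷ ys)
count-insertLevel f x [] = refl
count-insertLevel f x (y ∷ ys) with level x <? level y
... | yes _ = refl
... | no _  = trans (cong (indicator (f y) ℕ.+_) (count-insertLevel f x ys)) (x∙yz≈y∙xz (indicator (f y)) (indicator (f x)) (count f ys))

count-sweep : ∀ f xs → count f (sweep xs) ≡ count f xs
count-sweep f []       = refl
count-sweep f (x ∷ xs) = trans (count-insertLevel f x (sweep xs)) (cong (indicator (f x) ℕ.+_) (count-sweep f xs))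

scale : ℕ → Labelled → Labelled
scale n (l , c) = (+ n ℤ.* l , c)

labelsFrom-scale : ∀ k n s P → labelsFrom k n (+ n ℤ.* s) P ≡ map (scale n) (labelsFrom k 1 s P)
labelsFrom-scale k n s [] = refl
labelsFrom-scale k n s (N ∷ P) =
  cong ((+ n ℤ.* s , S) ∷_) (trans (cong (λ z → labelsFrom k n z P) (scale-up s)) (labelsFrom-scale k n _ P))
  where
  scale-up : ∀ s → + n ℤ.* s + + (k ℕ.* n) ≡ + n ℤ.* (s + + (k ℕ.* 1))
  scale-up s rewrite ℕP.*-identityʳ k | ℤP.pos-* k n = distrib (+ n) s (+ k)
    where distrib : ∀ a s b → a ℤ.* s + b ℤ.* a ≡ a ℤ.* (s + b)
          distrib = solve-∀
labelsFrom-scale k n s (E ∷ P) =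
  cong ((+ n ℤ.* s , W) ∷_) (trans (cong (λ z → labelsFrom k n z P) (scale-down s)) (labelsFrom-scale k n _ P))
  where
  scale-down : ∀ s → + n ℤ.* s - + n ≡ + n ℤ.* (s - + 1)
  scale-down s = trans (cong (λ z → + n ℤ.* s - z) (sym (ℤP.*-identityʳ (+ n)))) (distrib (+ n) s (+ 1))
    where distrib : ∀ a s b → a ℤ.* s - a ℤ.* b ≡ a ℤ.* (s - b)
          distrib = solve-∀

startLevels≡levels : ∀ k n s P → startLevels k n s P ≡ map level (labelsFrom k n s P)
startLevels≡levels k n s []      = refl
startLevels≡levels k n s (N ∷ P) = cong (s ∷_) (startLevels≡levels k n _ P)
startLevels≡levels k n s (E ∷ P) = cong (s ∷_) (startLevels≡levels k n _ P)

insertLevel-scale : ∀ n x ys → insertLevel (scale (suc n) x) (map (scale (suc n)) ys) ≡ map (scale (suc n)) (insertLevel x ys)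
insertLevel-scale n (a , c) [] = refl
insertLevel-scale n (a , c) ((b , d) ∷ ys) with a <? b | + suc n ℤ.* a <? + suc n ℤ.* b
... | yes _   | yes _    = refl
... | no _    | no _     = cong ((+ suc n ℤ.* b , d) ∷_) (insertLevel-scale n (a , c) ys)
... | yes a<b | no na≮nb = ⊥-elim (na≮nb (ℤP.*-monoˡ-<-pos (+ suc n) a<b))
... | no a≮b  | yes na<nb = ⊥-elim (a≮b (ℤP.*-cancelˡ-<-nonNeg (+ suc n) na<nb))

sweep-scale : ∀ n xs → sweep (map (scale (suc n)) xs) ≡ map (scale (suc n)) (sweep xs)
sweep-scale n []       = refl
sweep-scale n (x ∷ xs) = trans (cong (insertLevel (scale (suc n) x)) (sweep-scale n xs)) (insertLevel-scale n x (sweep xs))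

-- The shape of the sweep output

data Rise (n : ℕ) (a : ℤ) : Labelled → Set where
  stay : ∀ {c} → Rise n a (a , c)
  rise : Rise n a (a + + n , W)

data Climb (n : ℕ) : ℤ → List Labelled → Set where
  []  : ∀ {a} → Climb n a []
  _∷_ : ∀ {a x xs} → Rise n a x → Climb n (level x) xs → Climb n a (x ∷ xs)

rise-≤ : ∀ {n a x} → Rise n a x → a ℤ.≤ level x
rise-≤         stay = ℤP.≤-refl
rise-≤ {n} {a} rise = ℤP.i≤i+j a (+ n)

climb-≥ : ∀ {n a xs} → Climb n a xs → All (λ y → a ℤ.≤ level y) xs
climb-≥ []       = []
climb-≥ (r ∷ cl) = rise-≤ r ∷ All.map (ℤP.≤-trans (rise-≤ r)) (climb-≥ cl)

climb-split : ∀ {n a} F p R → Climb n a ((F ∷ʳ p) ++ R) →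
  All (λ y → level y ℤ.≤ level p) (F ∷ʳ p) × Climb n (level p) R
climb-split []      p R (r ∷ cl) = ℤP.≤-refl ∷ [] , cl
climb-split (y ∷ F) p R (r ∷ cl) with climb-split F p R cl
... | below , rest = All.head (AllP.++⁻ʳ F (AllP.++⁻ˡ (F ∷ʳ p) (climb-≥ cl))) ∷ below , rest

unit-gap : ∀ {a s} → a ℤ.≤ s → s ℤ.< a + + 1 → s ≡ a
unit-gap {a} {s} a≤s s<a+1 = ℤP.≤-antisym s≤a a≤s
  where
  s≤a : s ℤ.≤ a
  s≤a = subst (s ℤ.≤_) (trans (cong ℤ.pred (ℤP.+-comm a (+ 1))) (ℤP.pred-suc a)) (ℤP.i<j⇒i≤pred[j] s<a+1)

i<i+pos : ∀ i {m} → 1 ℕ.≤ m → i ℤ.< i + + m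
i<i+pos i m≥1 = subst (ℤ._< i + + _) (ℤP.+-identityʳ i) (ℤP.+-monoʳ-< i (ℤ.+<+ m≥1))

afterStep : ℕ → Labelled → ℤ
afterStep k (s , S) = s + + (k ℕ.* 1)
afterStep k (s , W) = s - + 1

Reaches : ℤ → ℤ → List Labelled → Set
Reaches t a ys = t ℤ.≤ a ⊎ Any (λ y → t ℤ.≤ level y) ys

reaches-tail : ∀ {t a y ys} → Rise 1 a y → Reaches t a (y ∷ ys) → Reaches t (level y) ys
reaches-tail r (inj₁ t≤a)          = inj₁ (ℤP.≤-trans t≤a (rise-≤ r))
reaches-tail r (inj₂ (here t≤y))   = inj₁ t≤y
reaches-tail r (inj₂ (there reach)) = inj₂ reach

rise-last : ∀ k → 1 ℕ.≤ k → ∀ {a} x → a ℤ.≤ level x → afterStep k x ℤ.≤ a → Rise 1 a x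
rise-last (suc k) _ {a} (s , S) a≤s s+k≤a =
  ⊥-elim (ℤP.<-irrefl refl (ℤP.<-≤-trans (i<i+pos s (ℕ.s≤s ℕ.z≤n)) (ℤP.≤-trans s+k≤a a≤s)))
rise-last k _ {a} (s , W) a≤s s-1≤a with a ≟ s
... | yes refl = stay
... | no a≢s   = subst (λ l → Rise 1 a (l , W)) a+1≡s rise
  where
  cancel : ∀ s → s - + 1 + + 1 ≡ s
  cancel = solve-∀
  a≡s-1 : a ≡ s - + 1
  a≡s-1 = unit-gap s-1≤a (subst (a ℤ.<_) (sym (cancel s)) (ℤP.≤∧≢⇒< a≤s a≢s))
  a+1≡s : a + + 1 ≡ s
  a+1≡s = trans (cong (_+ + 1) a≡s-1) (cancel s)

insertLevel-climb : ∀ k → 1 ℕ.≤ k → ∀ x {a} ys → Climb 1 a ys → a ℤ.≤ level x →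
  Reaches (afterStep k x) a ys → Climb 1 a (insertLevel x ys)
insertLevel-climb k k≥1 x [] [] a≤x (inj₁ reach) = rise-last k k≥1 x a≤x reach ∷ []
insertLevel-climb k k≥1 (s , c) (y ∷ ys) (r ∷ cl) a≤s reach with s <? level y
... | no s≮y  = r ∷ insertLevel-climb k k≥1 (s , c) ys cl (ℤP.≮⇒≥ s≮y) (reaches-tail r reach)
... | yes s<y with r
...   | stay = ⊥-elim (ℤP.<-irrefl refl (ℤP.≤-<-trans a≤s s<y))
...   | rise with unit-gap a≤s s<y
...     | refl = stay ∷ rise ∷ cl

any-insertLevel : ∀ {P : Labelled → Set} x ys → P x → Any P (insertLevel x ys)
any-insertLevel x []       px = here px
any-insertLevel x (y ∷ ys) px with level x <? level y
... | yes _ = here px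
... | no _  = there (any-insertLevel x ys px)

insertLevel-climb-reaches : ∀ k → 1 ℕ.≤ k → ∀ x {ys} → + 0 ℤ.≤ level x →
  Climb 1 (+ 0) ys × Reaches (afterStep k x) (+ 0) ys →
  Climb 1 (+ 0) (insertLevel x ys) × Reaches (level x) (+ 0) (insertLevel x ys)
insertLevel-climb-reaches k k≥1 x {ys} x≥0 (cl , reach) =
  insertLevel-climb k k≥1 x ys cl x≥0 reach , inj₂ (any-insertLevel x ys ℤP.≤-refl)

sweep-climb : ∀ k → 1 ℕ.≤ k → ∀ s P → All (λ y → + 0 ℤ.≤ level y) (labelsFrom k 1 s P) → endLevel k 1 s P ≡ + 0 →
  Climb 1 (+ 0) (sweep (labelsFrom k 1 s P)) × Reaches s (+ 0) (sweep (labelsFrom k 1 s P))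
sweep-climb k k≥1 s []      _            end = [] , inj₁ (ℤP.≤-reflexive end)
sweep-climb k k≥1 s (N ∷ P) (s≥0 ∷ ≥0s) end = insertLevel-climb-reaches k k≥1 (s , S) s≥0 (sweep-climb k k≥1 _ P ≥0s end)
sweep-climb k k≥1 s (E ∷ P) (s≥0 ∷ ≥0s) end = insertLevel-climb-reaches k k≥1 (s , W) s≥0 (sweep-climb k k≥1 _ P ≥0s end)

climb-scale : ∀ n {a ys} → Climb 1 a ys → Climb n (+ n ℤ.* a) (map (scale n) ys)
climb-scale n [] = []
climb-scale n (stay ∷ cl) = stay ∷ climb-scale n cl
climb-scale n {a} (rise ∷ cl) = subst (λ l → Rise n (+ n ℤ.* a) (l , W)) (sym distrib) rise ∷ climb-scale n cl
  where
  distrib : + n ℤ.* (a + + 1) ≡ + n ℤ.* a + + n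
  distrib = trans (ℤP.*-distribˡ-+ (+ n) a (+ 1)) (cong (_+_ (+ n ℤ.* a)) (ℤP.*-identityʳ (+ n)))

climb-head : ∀ {n a p w} → Climb n a (p ∷ w) → Any (λ y → level y ≡ a) (p ∷ w) → level p ≡ a
climb-head (r ∷ cl) (here p≡a)   = p≡a
climb-head (r ∷ cl) (there some) = ℤP.≤-antisym (lowest (climb-≥ cl) some) (rise-≤ r)
  where
  lowest : ∀ {l a ys} → All (λ y → l ℤ.≤ level y) ys → Any (λ y → level y ≡ a) ys → l ℤ.≤ a
  lowest (l≤y ∷ _)  (here refl)  = l≤y
  lowest (_ ∷ all) (there some) = lowest all some

-- The reconstruction algorithm

at-++ : ∀ {A : Set} (xs : List A) {y ys i} → length xs ≡ i → at (xs ++ y ∷ ys) i ≡ just y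
at-++ []       refl = refl
at-++ (x ∷ xs) refl = at-++ xs refl

set-++ : ∀ {A : Set} (xs : List A) {a y ys i} → length xs ≡ i → set i a (xs ++ y ∷ ys) ≡ xs ++ a ∷ ys
set-++ []       refl = refl
set-++ (x ∷ xs) refl = cong (x ∷_) (set-++ xs refl)

take-++ : ∀ {A : Set} (xs : List A) {ys i} → length xs ≡ i → take i (xs ++ ys) ≡ xs
take-++ []       refl = refl
take-++ (x ∷ xs) refl = cong (x ∷_) (take-++ xs refl)

drop-++ : ∀ {A : Set} (xs : List A) {ys i} → length xs ≡ i → drop i (xs ++ ys) ≡ ys
drop-++ []       refl = refl
drop-++ (x ∷ xs) refl = drop-++ xs refl


length-∷ʳ : ∀ {A : Set} (xs : List A) x → length (xs ∷ʳ x) ≡ suc (length xs)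
length-∷ʳ []       x = refl
length-∷ʳ (y ∷ xs) x = cong suc (length-∷ʳ xs x)

map-∷ʳ-++ : ∀ {A B : Set} (f : A → B) xs x ys → map f (xs ∷ʳ x) ++ ys ≡ map f xs ++ f x ∷ ys
map-∷ʳ-++ f []       x ys = refl
map-∷ʳ-++ f (y ∷ xs) x ys = cong (f y ∷_) (map-∷ʳ-++ f xs x ys)

assigned : Labelled → Maybe ℤ
assigned x = just (level x)

-- The entries of τ at unprocessed positions while level L is being processed:
-- only the east steps at level L have been assigned (by an earlier rise to L).
known : ℤ → Labelled → Maybe ℤ
known L (l , S) = nothing
known L (l , W) = if L ≡ᵇ l then just l else nothing

blank : List Labelled → List (Maybe ℤ)
blank D = replicate (length D) nothing

known-self : ∀ L → known L (L , W) ≡ just L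
known-self L = cong (if_then just L else nothing) (≡ᵇ-refl L)

known-blank : ∀ M D → count (isW atLevel M) D ≡ 0 → map (known M) D ≡ blank D
known-blank M []            _    = refl
known-blank M ((l , S) ∷ D) none = cong (nothing ∷_) (known-blank M D none)
known-blank M ((l , W) ∷ D) none with M ≡ᵇ l
... | false = cong (nothing ∷_) (known-blank M D none)

count-below : ∀ p X {L} Pre D → All (λ y → L ℤ.< level y) D → X ℤ.≤ L →
  count (p atLevel X) (Pre ++ D) ≡ count (p atLevel X) Pre
count-below p X Pre D D>L X≤L = begin
  count (p atLevel X) (Pre ++ D)                         ≡⟨ count-++ (p atLevel X) Pre D ⟩
  count (p atLevel X) Pre ℕ.+ count (p atLevel X) D      ≡⟨ cong (count (p atLevel X) Pre ℕ.+_) absent ⟩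
  count (p atLevel X) Pre ℕ.+ 0                          ≡⟨ ℕP.+-identityʳ _ ⟩
  count (p atLevel X) Pre                                ∎
  where absent = count-atLevel-absent p X D (All.map (λ L<y → ℤP.<⇒≢ (ℤP.≤-<-trans X≤L L<y)) D>L)

count-above : ∀ p X {L} Pre D → All (λ y → level y ℤ.≤ L) Pre → L ℤ.< X →
  count (p atLevel X) (Pre ++ D) ≡ count (p atLevel X) D
count-above p X Pre D Pre≤L L<X =
  trans (count-++ (p atLevel X) Pre D) (cong (ℕ._+ count (p atLevel X) D) absent)
  where absent = count-atLevel-absent p X Pre (All.map (λ y≤L → ≢-sym (ℤP.<⇒≢ (ℤP.≤-<-trans y≤L L<X))) Pre≤L)

assignW-climb : ∀ {n a} M D → Climb n a D → M ℤ.≤ a → ∀ c → count (isW atLevel M) D ≡ c →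
  assignW c M (map proj₂ D) (blank D) ≡ map (known M) D
assignW-climb M D cl M≤a zero none = sym (known-blank M D none)
assignW-climb M ((l , S) ∷ D) (r ∷ cl) M≤a (suc c) eq =
  cong (nothing ∷_) (assignW-climb M D cl (ℤP.≤-trans M≤a (rise-≤ r)) (suc c) eq)
assignW-climb M ((l , W) ∷ D) (r ∷ cl) M≤a (suc c) eq with M ≟ l
... | yes refl = cong (just M ∷_) (assignW-climb M D cl ℤP.≤-refl c (ℕP.suc-injective eq))
... | no M≢l   = ⊥-elim (ℕP.0≢1+n (trans (sym none) eq))
  where
  M<l : M ℤ.< l
  M<l = ℤP.≤∧≢⇒< (ℤP.≤-trans M≤a (rise-≤ r)) M≢l
  none : count (isW atLevel M) D ≡ 0
  none = count-atLevel-absent isW M D (All.map (λ l≤y → ℤP.<⇒≢ (ℤP.<-≤-trans M<l l≤y)) (climb-≥ cl))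

countEq-++ : ∀ v xs ys → countEq v (xs ++ ys) ≡ countEq v xs ℕ.+ countEq v ys
countEq-++ v xs ys = trans (cong length (LP.filter-++ _ xs ys)) (LP.length-++ (filter _ xs))

countEq-assigned : ∀ v xs → countEq v (map assigned xs) ≡ departures v xs
countEq-assigned v []             = refl
countEq-assigned v ((l , c) ∷ xs) with v ≟ l
... | yes _ = cong suc (countEq-assigned v xs)
... | no _  = countEq-assigned v xs

countEq-blank : ∀ v D → countEq v (blank D) ≡ 0
countEq-blank v []      = refl
countEq-blank v (_ ∷ D) = countEq-blank v D

countEqS-++ : ∀ v σ₁ σ₂ τ₁ τ₂ → length σ₁ ≡ length τ₁ →
  countEqS v (σ₁ ++ σ₂) (τ₁ ++ τ₂) ≡ countEqS v σ₁ τ₁ ℕ.+ countEqS v σ₂ τ₂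
countEqS-++ v []      σ₂ []      τ₂ _ = refl
countEqS-++ v (S ∷ σ₁) σ₂ (t ∷ τ₁) τ₂ eq with isJust≡ v t
... | true  = cong suc (countEqS-++ v σ₁ σ₂ τ₁ τ₂ (ℕP.suc-injective eq))
... | false = countEqS-++ v σ₁ σ₂ τ₁ τ₂ (ℕP.suc-injective eq)
countEqS-++ v (W ∷ σ₁) σ₂ (t ∷ τ₁) τ₂ eq = countEqS-++ v σ₁ σ₂ τ₁ τ₂ (ℕP.suc-injective eq)

countEqS-assigned : ∀ v xs → countEqS v (map proj₂ xs) (map assigned xs) ≡ count (isS atLevel v) xs
countEqS-assigned v []             = refl
countEqS-assigned v ((l , S) ∷ xs) with v ≟ l
... | yes _ = cong suc (countEqS-assigned v xs)
... | no _  = countEqS-assigned v xs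
countEqS-assigned v ((l , W) ∷ xs) = countEqS-assigned v xs

countEqS-blank : ∀ v σ D → countEqS v σ (blank D) ≡ 0
countEqS-blank v []      D       = refl
countEqS-blank v (S ∷ σ) []      = refl
countEqS-blank v (W ∷ σ) []      = refl
countEqS-blank v (S ∷ σ) (_ ∷ D) = countEqS-blank v σ D
countEqS-blank v (W ∷ σ) (_ ∷ D) = countEqS-blank v σ D

algStep-assigned : ∀ k n σ τ j {v} → at τ (suc j) ≡ just (just v) → algStep k n σ τ (suc j) ≡ τ
algStep-assigned k n σ τ j eq rewrite eq = refl

algStep-S : ∀ k n σ τ j {L} → at τ (suc j) ≡ just nothing → at τ j ≡ just (just L) → at σ (suc j) ≡ just S →
  algStep k n σ τ (suc j) ≡ set (suc j) (just L) τ
algStep-S k n σ τ j eq₁ eq₂ eq₃ rewrite eq₁ | eq₂ | eq₃ = refl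

algStep-W : ∀ k n σ τ j {L} c → at τ (suc j) ≡ just nothing → at τ j ≡ just (just L) → at σ (suc j) ≡ just W →
  + countEq L τ - + countEqS (L - + (k ℕ.* n)) σ τ ≡ + suc c →
  algStep k n σ τ (suc j) ≡ assignFrom (suc j) (suc c) (L + + n) σ τ
algStep-W k n σ τ j c eq₁ eq₂ eq₃ eq₄ rewrite eq₁ | eq₂ | eq₃ | eq₄ = refl

-- τ after processing the steps F ∷ʳ p of the sweep output, when the remaining ones are R
snapshot : List Labelled → Labelled → List Labelled → List (Maybe ℤ)
snapshot F p R = map assigned (F ∷ʳ p) ++ map (known (level p)) R

length-map-∷ʳ : ∀ {A B : Set} (f : A → B) xs x → length (map f (xs ∷ʳ x)) ≡ suc (length xs)
length-map-∷ʳ f xs x = trans (LP.length-map f (xs ∷ʳ x)) (length-∷ʳ xs x)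

snapshot-previous : ∀ F p ys → at (map assigned (F ∷ʳ p) ++ ys) (length F) ≡ just (just (level p))
snapshot-previous F p ys =
  trans (cong (λ τ → at τ (length F)) (map-∷ʳ-++ assigned F p ys)) (at-++ (map assigned F) (LP.length-map assigned F))

snapshot-next : ∀ F p y ys → at (map assigned (F ∷ʳ p) ++ y ∷ ys) (suc (length F)) ≡ just y
snapshot-next F p y ys = at-++ (map assigned (F ∷ʳ p)) (length-map-∷ʳ assigned F p)

letter-next : ∀ (F : List Labelled) p x R → at (map proj₂ ((F ∷ʳ p) ++ x ∷ R)) (suc (length F)) ≡ just (proj₂ x)
letter-next F p x R = trans (cong (λ σ → at σ (suc (length F))) (LP.map-++ proj₂ (F ∷ʳ p) (x ∷ R)))
                            (at-++ (map proj₂ (F ∷ʳ p)) (length-map-∷ʳ proj₂ F p))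

module Reconstruction (k n : ℕ) (n≥1 : 1 ℕ.≤ n) (first : Labelled) (rest : List Labelled)
  (climb : Climb n (+ 0) (first ∷ rest)) (first≡0 : level first ≡ + 0)
  (balanced : ∀ L → departures L (first ∷ rest) ≡ arrivals k n L (first ∷ rest)) where

  w : List Labelled
  w = first ∷ rest

  σ : List Letter
  σ = map proj₂ w

  letter-of : ∀ {F p x R} → w ≡ (F ∷ʳ p) ++ x ∷ R → at σ (suc (length F)) ≡ just (proj₂ x)
  letter-of {F} {p} {x} {R} w≡ = trans (cong (λ v → at (map proj₂ v) (suc (length F))) w≡) (letter-next F p x R)

  module AtRise (F : List Labelled) (p : Labelled) (R : List Labelled)
    (w≡ : w ≡ (F ∷ʳ p) ++ (level p + + n , W) ∷ R)
    (Pre≤L : All (λ y → level y ℤ.≤ level p) (F ∷ʳ p)) (cl : Climb n (level p + + n) R) where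

    L M v : ℤ
    L = level p
    M = L + + n
    v = L - + (k ℕ.* n)

    Pre D : List Labelled
    Pre = F ∷ʳ p
    D = (M , W) ∷ R

    T : List (Maybe ℤ)
    T = map assigned Pre

    C : ℕ
    C = count (isW atLevel M) R

    L<M : L ℤ.< M
    L<M = i<i+pos L n≥1

    D>L : All (λ y → L ℤ.< level y) D
    D>L = L<M ∷ All.map (ℤP.<-≤-trans L<M) (climb-≥ cl)

    unassigned : map (known L) D ≡ blank D
    unassigned = known-blank L D (count-atLevel-absent isW L D (All.map ℤP.<⇒≢ D>L))

    rises-in-D : count (isW atLevel M) D ≡ suc C
    rises-in-D = cong (λ b → indicator b ℕ.+ C) (≡ᵇ-refl M)

    σ-split : σ ≡ map proj₂ Pre ++ map proj₂ D
    σ-split = trans (cong (map proj₂) w≡) (LP.map-++ proj₂ Pre D)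

    departures-L : countEq L (T ++ blank D) ≡ departures L w
    departures-L = begin
      countEq L (T ++ blank D)             ≡⟨ countEq-++ L T (blank D) ⟩
      countEq L T ℕ.+ countEq L (blank D)  ≡⟨ cong₂ ℕ._+_ (countEq-assigned L Pre) (countEq-blank L D) ⟩
      departures L Pre ℕ.+ 0               ≡⟨ ℕP.+-identityʳ _ ⟩
      departures L Pre                     ≡⟨ count-below anyLetter L Pre D D>L ℤP.≤-refl ⟨
      departures L (Pre ++ D)              ≡⟨ cong (departures L) w≡ ⟨
      departures L w                       ∎

    souths-v : countEqS v σ (T ++ blank D) ≡ count (isS atLevel v) w
    souths-v = begin
      countEqS v σ (T ++ blank D)
        ≡⟨ cong (λ σ' → countEqS v σ' (T ++ blank D)) σ-split ⟩
      countEqS v (map proj₂ Pre ++ map proj₂ D) (T ++ blank D)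
        ≡⟨ countEqS-++ v (map proj₂ Pre) (map proj₂ D) T (blank D) same-length ⟩
      countEqS v (map proj₂ Pre) T ℕ.+ countEqS v (map proj₂ D) (blank D)
        ≡⟨ cong₂ ℕ._+_ (countEqS-assigned v Pre) (countEqS-blank v (map proj₂ D) D) ⟩
      count (isS atLevel v) Pre ℕ.+ 0
        ≡⟨ ℕP.+-identityʳ _ ⟩
      count (isS atLevel v) Pre
        ≡⟨ count-below isS v Pre D D>L (ℤP.i-j≤i L (+ (k ℕ.* n))) ⟨
      count (isS atLevel v) (Pre ++ D)
        ≡⟨ cong (count (isS atLevel v)) w≡ ⟨
      count (isS atLevel v) w
        ∎
      where
      same-length : length (map proj₂ Pre) ≡ length T
      same-length = trans (LP.length-map proj₂ Pre) (sym (LP.length-map assigned Pre))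

    rises-M : count (isW atLevel M) w ≡ suc C
    rises-M = trans (cong (count (isW atLevel M)) w≡) (trans (count-above isW M Pre D Pre≤L L<M) rises-in-D)

    gap : + countEq L (T ++ blank D) - + countEqS v σ (T ++ blank D) ≡ + suc C
    gap = begin
      + countEq L (T ++ blank D) - + countEqS v σ (T ++ blank D)  ≡⟨ cong₂ (λ a b → + a - + b) departures-L souths-v ⟩
      + departures L w - + t                                      ≡⟨ cong (λ a → + a - + t) (balanced L) ⟩
      + (count (isW atLevel M) w ℕ.+ t) - + t                     ≡⟨ cong (λ a → + (a ℕ.+ t) - + t) rises-M ⟩
      + (suc C ℕ.+ t) - + t                                       ≡⟨ cong (_- + t) (ℤP.pos-+ (suc C) t) ⟩
      + suc C + + t - + t                                         ≡⟨ cancel (+ suc C) (+ t) ⟩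
      + suc C                                                     ∎
      where
      t = count (isS atLevel v) w
      cancel : ∀ a b → a + b - b ≡ a
      cancel = solve-∀

    step-rise : algStep k n σ (snapshot F p D) (suc (length F)) ≡ snapshot Pre (M , W) R
    step-rise = begin
      algStep k n σ (T ++ map (known L) D) (suc |F|)
        ≡⟨ cong (λ τ → algStep k n σ (T ++ τ) (suc |F|)) unassigned ⟩
      algStep k n σ (T ++ blank D) (suc |F|)
        ≡⟨ algStep-W k n σ (T ++ blank D) |F| C (snapshot-next F p nothing (blank R)) (snapshot-previous F p (blank D)) (letter-of w≡) gap ⟩
      assignFrom (suc |F|) (suc C) M σ (T ++ blank D)
        ≡⟨ cong₂ _++_ (take-++ T |T|) (cong₂ (assignW (suc C) M) σ-rest (drop-++ T |T|)) ⟩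
      T ++ assignW (suc C) M (map proj₂ D) (blank D)
        ≡⟨ cong (T ++_) (assignW-climb M D (stay ∷ cl) ℤP.≤-refl (suc C) rises-in-D) ⟩
      T ++ map (known M) D
        ≡⟨ cong (λ t → T ++ t ∷ map (known M) R) (known-self M) ⟩
      T ++ just M ∷ map (known M) R
        ≡⟨ map-∷ʳ-++ assigned Pre (M , W) (map (known M) R) ⟨
      snapshot Pre (M , W) R
        ∎
      where
      |F| = length F
      |T| = length-map-∷ʳ assigned F p
      σ-rest : drop (suc |F|) σ ≡ map proj₂ D
      σ-rest = trans (cong (drop (suc |F|)) σ-split) (drop-++ (map proj₂ Pre) (length-map-∷ʳ proj₂ F p))

  step : ∀ F p x R → w ≡ (F ∷ʳ p) ++ x ∷ R →
    algStep k n σ (snapshot F p (x ∷ R)) (suc (length F)) ≡ snapshot (F ∷ʳ p) x R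
  step F p x R w≡ with climb-split F p (x ∷ R) (subst (Climb n (+ 0)) w≡ climb)
  ... | Pre≤L , stay {S} ∷ _ = begin
    algStep k n σ (T ++ nothing ∷ M) (suc |F|)
      ≡⟨ algStep-S k n σ _ |F| (snapshot-next F p nothing M) (snapshot-previous F p _) (letter-of w≡) ⟩
    set (suc |F|) (just L) (T ++ nothing ∷ M)
      ≡⟨ set-++ T (length-map-∷ʳ assigned F p) ⟩
    T ++ just L ∷ M
      ≡⟨ map-∷ʳ-++ assigned (F ∷ʳ p) (L , S) M ⟨
    snapshot (F ∷ʳ p) (L , S) R
      ∎
    where
    L = level p
    T = map assigned (F ∷ʳ p)
    M = map (known L) R
    |F| = length F
  ... | Pre≤L , stay {W} ∷ _ = begin
    algStep k n σ (T ++ known L (L , W) ∷ M) (suc |F|)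
      ≡⟨ algStep-assigned k n σ _ |F| (trans (snapshot-next F p _ M) (cong just (known-self L))) ⟩
    T ++ known L (L , W) ∷ M
      ≡⟨ cong (λ t → T ++ t ∷ M) (known-self L) ⟩
    T ++ just L ∷ M
      ≡⟨ map-∷ʳ-++ assigned (F ∷ʳ p) (L , W) M ⟨
    snapshot (F ∷ʳ p) (L , W) R
      ∎
    where
    L = level p
    T = map assigned (F ∷ʳ p)
    M = map (known L) R
    |F| = length F
  ... | Pre≤L , rise ∷ cl = AtRise.step-rise F p R w≡ Pre≤L cl

  run : ∀ F p R (f : ℕ → ℕ) → (∀ i → f i ≡ suc (length F) ℕ.+ i) → w ≡ (F ∷ʳ p) ++ R →
    foldl (algStep k n σ) (snapshot F p R) (applyUpTo f (length R)) ≡ map just (map level w)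
  run F p [] f f≗ w≡ = begin
    map assigned (F ∷ʳ p) ++ []    ≡⟨ LP.++-identityʳ _ ⟩
    map assigned (F ∷ʳ p)          ≡⟨ LP.map-∘ (F ∷ʳ p) ⟩
    map just (map level (F ∷ʳ p))  ≡⟨ cong (map just ∘ map level) (trans w≡ (LP.++-identityʳ _)) ⟨
    map just (map level w)         ∎
  run F p (x ∷ R) f f≗ w≡ = begin
    foldl g (g (snapshot F p (x ∷ R)) (f 0)) is
      ≡⟨ cong (λ i → foldl g (g (snapshot F p (x ∷ R)) i) is) (trans (f≗ 0) (ℕP.+-identityʳ _)) ⟩
    foldl g (g (snapshot F p (x ∷ R)) (suc |F|)) is
      ≡⟨ cong (λ τ → foldl g τ is) (step F p x R w≡) ⟩
    foldl g (snapshot (F ∷ʳ p) x R) is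
      ≡⟨ run (F ∷ʳ p) x R (f ∘ suc) f∘suc≗ (trans w≡ (sym (LP.∷ʳ-++ (F ∷ʳ p) x R))) ⟩
    map just (map level w)
      ∎
    where
    g = algStep k n σ
    is = applyUpTo (f ∘ suc) (length R)
    |F| = length F
    f∘suc≗ : ∀ i → f (suc i) ≡ suc (length (F ∷ʳ p)) ℕ.+ i
    f∘suc≗ i = trans (f≗ (suc i)) (trans (ℕP.+-suc (suc |F|) i) (cong (λ m → suc m ℕ.+ i) (sym (length-∷ʳ F p))))

  no-rise-to-0 : count (isW atLevel (+ 0)) rest ≡ 0
  no-rise-to-0 = ℕP.m+n≡0⇒n≡0 (indicator ((isW atLevel (+ 0)) first)) (begin
    count (isW atLevel (+ 0)) w          ≡⟨ cong (λ L → count (isW atLevel L) w) (ℤP.+-inverseˡ (+ n)) ⟨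
    count (isW atLevel (ℤ.- + n + + n)) w ≡⟨ ℕP.m+n≡0⇒m≡0 _ nothing-below-0 ⟩
    0                                    ∎)
    where
    -n<0 : ℤ.- + n ℤ.< + 0
    -n<0 = ℤP.neg-mono-< (ℤ.+<+ n≥1)
    nothing-below-0 : arrivals k n (ℤ.- + n) w ≡ 0
    nothing-below-0 = trans (sym (balanced (ℤ.- + n)))
      (count-atLevel-absent anyLetter (ℤ.- + n) w (All.map (λ 0≤y → ℤP.<⇒≢ (ℤP.<-≤-trans -n<0 0≤y)) (climb-≥ climb)))

  correct : runAlg k n σ ≡ map just (map level w)
  correct = begin
    foldl (algStep k n σ) (just (+ 0) ∷ replicate |rest| nothing) (map suc (upTo |rest|))
      ≡⟨ cong₂ (foldl (algStep k n σ)) initial indices ⟩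
    foldl (algStep k n σ) (snapshot [] first rest) (applyUpTo suc (length rest))
      ≡⟨ run [] first rest suc (λ _ → refl) refl ⟩
    map just (map level w) ∎
    where
    |rest| = length (map proj₂ rest)
    initial : just (+ 0) ∷ replicate |rest| nothing ≡ snapshot [] first rest
    initial = cong₂ _∷_ (cong just (sym first≡0))
      (trans (cong (λ m → replicate m nothing) (LP.length-map proj₂ rest))
             (sym (known-blank (level first) rest (subst (λ L → count (isW atLevel L) rest ≡ 0) (sym first≡0) no-rise-to-0))))
    indices : map suc (upTo |rest|) ≡ applyUpTo suc (length rest)
    indices = trans (LP.map-upTo suc |rest|) (cong (applyUpTo suc) (LP.length-map proj₂ rest))

reconstruction : ∀ k n → 1 ℕ.≤ n → ∀ w → Climb n (+ 0) w → Any (λ y → level y ≡ + 0) w →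
  (∀ L → departures L w ≡ arrivals k n L w) → runAlg k n (map proj₂ w) ≡ map just (map level w)
reconstruction k n n≥1 (first ∷ rest) climb visits balanced =
  Reconstruction.correct k n n≥1 first rest climb (climb-head climb visits) balanced

sweep-visits-start : ∀ k n s P → 1 ℕ.≤ countN P → Any (λ y → level y ≡ s) (sweep (labelsFrom k n s P))
sweep-visits-start k n s (N ∷ P) _ = any-insertLevel (s , S) (sweep (labelsFrom k n _ P)) refl
sweep-visits-start k n s (E ∷ P) _ = any-insertLevel (s , W) (sweep (labelsFrom k n _ P)) refl

dyck-sweep-climb : ∀ {k n P} → 1 ℕ.≤ k → 1 ℕ.≤ n → IsDyck k n P → Climb n (+ 0) (sweep (labelsFrom k n (+ 0) P))
dyck-sweep-climb {k} {suc n} {P} k≥1 _ dyck =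
  subst₂ (Climb (suc n)) (ℤP.*-zeroʳ (+ suc n)) (sym sweep-scaled)
    (climb-scale (suc n) (proj₁ (sweep-climb k k≥1 (+ 0) P unit-nonneg (dyck-closed dyck 1 (+ 0)))))
  where
  unit = labelsFrom k 1 (+ 0) P
  scaled : labelsFrom k (suc n) (+ 0) P ≡ map (scale (suc n)) unit
  scaled = trans (cong (λ s → labelsFrom k (suc n) s P) (sym (ℤP.*-zeroʳ (+ suc n)))) (labelsFrom-scale k (suc n) (+ 0) P)
  sweep-scaled : sweep (labelsFrom k (suc n) (+ 0) P) ≡ map (scale (suc n)) (sweep unit)
  sweep-scaled = trans (cong sweep scaled) (sweep-scale n unit)
  unscale : ∀ {l} → + 0 ℤ.≤ + suc n ℤ.* l → + 0 ℤ.≤ l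
  unscale {l} 0≤nl = ℤP.*-cancelˡ-≤-pos (+ 0) l (+ suc n) (subst (ℤ._≤ + suc n ℤ.* l) (sym (ℤP.*-zeroʳ (+ suc n))) 0≤nl)
  unit-nonneg : All (λ y → + 0 ℤ.≤ level y) unit
  unit-nonneg = All.map unscale (AllP.map⁻ (AllP.map⁻ (subst (All (+ 0 ℤ.≤_))
    (trans (startLevels≡levels k (suc n) (+ 0) P) (cong (map level) scaled)) (IsDyck.nonneg dyck))))

theorem2p2 : (k n : ℕ) → 1 ℕ.≤ k → 1 ℕ.≤ n → (P : List Step) → IsDyck k n P →
    runAlg k n (sweepWord k n P) ≡ map just (sweepLevels k n P)
theorem2p2 k n k≥1 n≥1 P dyck = begin
  runAlg k n (sweepWord k n P)  ≡⟨ cong (runAlg k n ∘ map proj₂) (sweepRL≡sweep k n P) ⟩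
  runAlg k n (map proj₂ w)      ≡⟨ reconstruction k n n≥1 w (dyck-sweep-climb k≥1 n≥1 dyck) visits balanced ⟩
  map just (map level w)        ≡⟨ cong (map just ∘ map level) (sweepRL≡sweep k n P) ⟨
  map just (sweepLevels k n P)  ∎
  where
  xs = labelsFrom k n (+ 0) P
  w = sweep xs
  visits : Any (λ y → level y ≡ + 0) w
  visits = sweep-visits-start k n (+ 0) P (subst (1 ℕ.≤_) (sym (IsDyck.northCount dyck)) n≥1)
  balanced : ∀ L → departures L w ≡ arrivals k n L w
  balanced L = begin
    departures L w     ≡⟨ count-sweep (anyLetter atLevel L) xs ⟩
    departures L xs    ≡⟨ dyck-balance dyck L ⟩
    arrivals k n L xs
      ≡⟨ cong₂ ℕ._+_ (count-sweep (isW atLevel (L + + n)) xs) (count-sweep (isS atLevel (L - + (k ℕ.* n))) xs) ⟨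
    arrivals k n L w   ∎
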